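{- Let $d\ge0$. A $d$-ascent sequence $\alpha\in A_d$ is self-modified (i.e. $\mathrm{hat}_d(\alpha)=\alpha$) if and only if it can be written as a concatenation $\alpha=1B_12B_2\ldots kB_k$, where $k=\max\alpha$, each $B_i$ is a (possibly empty) word, and each factor $iB_i$ is decreasing with pace $d$.
   Context: All sequences are finite words $\alpha=a_1\ldots a_n$ of positive integers. For an integer $d\ge 0$, an index $i\in[n]$ is a $d$-ascent of $\alpha$ if $i=1$, or $i\ge 2$ and $a_i>a_{i-1}-d$; $\mathrm{asc}_d\alpha$ is the number of $d$-ascents. $\alpha$ is a $d$-ascent sequence if $a_i\le1+\mathrm{asc}_d(a_1\ldots a_{i-1})$ for all $i\in[n]$; $A_d$ is the set of these. For a word $\alpha$ and index $j$, $M(\alpha,j)$ adds $1$ to every $a_i$ with $i<j$ and $a_i\ge a_j$; $M(\alpha,j_1,\dots,j_k)=M(M(\alpha,j_1,\dots,j_{k-1}),j_k)$; $\mathrm{hat}_d(\alpha)=M(\alpha,j_1,\dots,j_k)$ with $j_1<\dots<j_k$ the $d$-ascents of $\alpha$. A word $c_1c_2\ldots c_\ell$ is decreasing with pace $d$ if $c_j-c_{j+1}\ge d$ for all $1\le j<\ell$. -}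

module Defs where

open import Data.Nat using (ℕ; zero; suc; _+_; _≤_; _<_; _≥_; _<ᵇ_; _≤ᵇ_)
open import Data.Bool using (Bool; true; false; if_then_else_)
open import Data.List using (List; []; _∷_; _++_; length; take; drop; map; foldl; concat; upTo; lookup; filter; zipWith)
open import Data.List.Relation.Unary.All using (All)
open import Data.Fin using (Fin; toℕ)
open import Data.Product using (Σ; _×_; _,_; ∃)
open import Relation.Binary.PropositionalEquality using (_≡_)
open import Data.Maybe using (Maybe; just; nothing)

-- Words are lists of natural numbers; positivity is imposed separately.
-- Positions are 0-based internally: list position p corresponds to index p+1 of the paper.

maxW : List ℕ → ℕ
maxW [] = 0
maxW (a ∷ as) = a Data.Nat.⊔ maxW as

-- Position 0 always is; position p+1 is iff a_{p+1} > a_p - d, i.e. a_p < a_{p+1} + d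
-- (with integer subtraction; for d ≥ 0 this is the same as a_{p+1} + d > a_p).
isAscAt : ℕ → List ℕ → ℕ → Bool
isAscAt d [] p = false
isAscAt d (a ∷ as) zero = true
isAscAt d (a ∷ []) (suc p) = false
isAscAt d (a ∷ b ∷ as) (suc zero) = a <ᵇ (b + d)
isAscAt d (a ∷ b ∷ as) (suc (suc p)) = isAscAt d (b ∷ as) (suc p)

ascents : ℕ → List ℕ → List ℕ
ascents d α = filter (λ p → isAscAt d α p Data.Bool.≟ true) (upTo (length α))

asc : ℕ → List ℕ → ℕ
asc d α = length (ascents d α)

IsAscentSeq : ℕ → List ℕ → Set
IsAscentSeq d α =
  All (λ a → 1 ≤ a) α ×
  ((i : Fin (length α)) → lookup α i ≤ suc (asc d (take (toℕ i) α)))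

at : List ℕ → ℕ → Maybe ℕ
at [] p = nothing
at (a ∷ as) zero = just a
at (a ∷ as) (suc p) = at as p

incGe : ℕ → List ℕ → List ℕ
incGe v = map (λ a → if v ≤ᵇ a then suc a else a)

M : List ℕ → ℕ → List ℕ
M α j with at α j
... | nothing = α
... | just v = incGe v (take j α) ++ drop j α

hat : ℕ → List ℕ → List ℕ
hat d α = foldl M α (ascents d α)

data DecPace (d : ℕ) : List ℕ → Set where
  []  : DecPace d []
  [_] : ∀ c → DecPace d (c ∷ [])
  _∷_ : ∀ {c c' cs} → c' + d ≤ c → DecPace d (c' ∷ cs) → DecPace d (c ∷ c' ∷ cs)

blocks : ℕ → List (List ℕ) → List (List ℕ)
blocks i [] = []
blocks i (B ∷ Bs) = (i ∷ B) ∷ blocks (suc i) Bs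

HasBlockForm : ℕ → List ℕ → Set
HasBlockForm d α =
  Σ (List (List ℕ)) λ Bs →
    length Bs ≡ maxW α ×
    concat (blocks 1 Bs) ≡ α ×
    All (DecPace d) (blocks 1 Bs)

-- Every step M(·, j) of hat only increases entries, so hat d α = α exactly when each step fixes
-- α, i.e. when every d-ascent is a record: an entry larger than every entry before it.  Reading
-- a d-ascent sequence with this property from left to right, the number of ascents so far and
-- the running maximum coincide (both start at 1, and each ascent is a new record, which the
-- ascent-sequence bound forces to be exactly one more than the maximum).  So every ascent
-- opens a new block with the next value, and every other entry lies at least d below its
-- predecessor; conversely a word in block form has only the block heads as ascents, and they
-- are records.
module Submission where

open import Defs
open import Data.Nat using (ℕ; zero; suc; _+_; _≤_; _<_; _⊔_; _<ᵇ_; _≤ᵇ_; z≤n; s≤s)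
open import Data.Nat.Properties
open import Data.Bool using (Bool; true; false; T)
import Data.Bool as Bool
open import Data.Bool.Properties using (T-≡)
open import Data.List using (List; []; _∷_; _++_; length; take; drop; foldl; concat; upTo; lookup; filter; applyUpTo)
open import Data.List.Properties using (++-cancelʳ; take++drop≡id; ∷-injectiveˡ; ∷-injectiveʳ)
open import Data.List.Relation.Binary.Pointwise as Pointwise using (Pointwise; []; _∷_; Pointwise-≡⇒≡)
open import Data.List.Relation.Binary.Pointwise.Properties using (antisymmetric)
open import Data.List.Relation.Unary.All as All using (All; []; _∷_)
open import Data.List.Membership.Propositional.Properties using (∈-upTo⁺; ∈-filter⁺; ∈-filter⁻)
open import Data.Fin using (Fin; toℕ) renaming (zero to fzero; suc to fsuc)
open import Data.Product using (Σ; _×_; _,_; proj₁; proj₂; uncurry)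
open import Data.Maybe using (just; nothing)
open import Function using (_∘_; id)
open import Function.Bundles using (_⇔_; mk⇔; Equivalence)
import Function.Properties.Equivalence as ⇔
open import Function.Related.Propositional using (module EquationalReasoning; equivalence)
open import Level using (0ℓ)
open import Relation.Binary using (Rel; Reflexive; Transitive; Antisymmetric)
open import Relation.Binary.PropositionalEquality
open import Relation.Nullary using (Dec; contradiction)
open import Relation.Nullary.Reflects using (ofʸ; ofⁿ)

module _ {A B : Set} {_⊑_ : Rel A 0ℓ}
  (⊑-refl : Reflexive _⊑_) (⊑-trans : Transitive _⊑_) (⊑-antisym : Antisymmetric _≡_ _⊑_)
  (f : A → B → A) (f-inflationary : ∀ x b → x ⊑ f x b)
  where

  foldl-inflationary : ∀ x bs → x ⊑ foldl f x bs
  foldl-inflationary x []       = ⊑-refl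
  foldl-inflationary x (b ∷ bs) = ⊑-trans (f-inflationary x b) (foldl-inflationary (f x b) bs)

  foldl-fixed⇔all-fixed : ∀ x bs → foldl f x bs ≡ x ⇔ All (λ b → f x b ≡ x) bs
  foldl-fixed⇔all-fixed x bs = mk⇔ (fixed⇒all bs) (all⇒fixed bs)
    where
    fixed⇒all : ∀ bs → foldl f x bs ≡ x → All (λ b → f x b ≡ x) bs
    fixed⇒all []       _  = []
    fixed⇒all (b ∷ bs) eq = fxb≡x ∷ fixed⇒all bs (subst (λ y → foldl f y bs ≡ x) fxb≡x eq)
      where
      fxb≡x : f x b ≡ x
      fxb≡x = ⊑-antisym (subst (f x b ⊑_) eq (foldl-inflationary (f x b) bs)) (f-inflationary x b)

    all⇒fixed : ∀ bs → All (λ b → f x b ≡ x) bs → foldl f x bs ≡ x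
    all⇒fixed []       []         = refl
    all⇒fixed (b ∷ bs) (eq ∷ eqs) = subst (λ y → foldl f y bs ≡ x) (sym eq) (all⇒fixed bs eqs)

incGe-inflationary : ∀ v xs → Pointwise _≤_ xs (incGe v xs)
incGe-inflationary v []       = []
incGe-inflationary v (a ∷ as) with v ≤ᵇ a
... | true  = n≤1+n a ∷ incGe-inflationary v as
... | false = ≤-refl  ∷ incGe-inflationary v as

incGe-fixed⇔all< : ∀ v xs → incGe v xs ≡ xs ⇔ All (_< v) xs
incGe-fixed⇔all< v xs = mk⇔ (fixed⇒all< xs) (all<⇒fixed xs)
  where
  fixed⇒all< : ∀ xs → incGe v xs ≡ xs → All (_< v) xs
  fixed⇒all< []       _  = []
  fixed⇒all< (a ∷ as) eq with v ≤ᵇ a | ≤ᵇ-reflects-≤ v a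
  ... | true  | _       = contradiction (∷-injectiveˡ eq) 1+n≢n
  ... | false | ofⁿ v≰a = ≰⇒> v≰a ∷ fixed⇒all< as (∷-injectiveʳ eq)

  all<⇒fixed : ∀ xs → All (_< v) xs → incGe v xs ≡ xs
  all<⇒fixed []       []           = refl
  all<⇒fixed (a ∷ as) (a<v ∷ as<v) with v ≤ᵇ a | ≤ᵇ-reflects-≤ v a
  ... | true  | ofʸ v≤a = contradiction v≤a (<⇒≱ a<v)
  ... | false | _       = cong (a ∷_) (all<⇒fixed as as<v)

M-inflationary : ∀ α j → Pointwise _≤_ α (M α j)
M-inflationary α j with at α j
... | nothing = Pointwise.refl ≤-refl
... | just v  = subst (λ β → Pointwise _≤_ β (incGe v (take j α) ++ drop j α)) (take++drop≡id j α)
                  (Pointwise.++⁺ (incGe-inflationary v (take j α)) (Pointwise.refl ≤-refl))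

M-fixed⇔ : ∀ α j → M α j ≡ α ⇔ (∀ v → at α j ≡ just v → All (_< v) (take j α))
M-fixed⇔ α j with at α j
... | nothing = mk⇔ (λ _ _ ()) (λ _ → refl)
... | just v  = ⇔.trans prefix-fixed (⇔.trans (incGe-fixed⇔all< v (take j α)) at-just)
  where
  prefix-fixed : incGe v (take j α) ++ drop j α ≡ α ⇔ incGe v (take j α) ≡ take j α
  prefix-fixed = mk⇔
    (λ eq → ++-cancelʳ (drop j α) _ _ (trans eq (sym (take++drop≡id j α))))
    (λ eq → trans (cong (_++ drop j α) eq) (take++drop≡id j α))

  at-just : All (_< v) (take j α) ⇔ (∀ w → just v ≡ just w → All (_< w) (take j α))
  at-just = mk⇔ (λ { all<v _ refl → all<v }) (λ all< → all< v refl)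

at⇒<length : ∀ α j {v} → at α j ≡ just v → j < length α
at⇒<length (a ∷ as) zero    _  = s≤s z≤n
at⇒<length (a ∷ as) (suc j) eq = s≤s (at⇒<length as j eq)

AscentsAreRecords : ℕ → List ℕ → Set
AscentsAreRecords d α = ∀ j v → T (isAscAt d α j) → at α j ≡ just v → All (_< v) (take j α)

selfModified⇔ascentsAreRecords : ∀ d α → hat d α ≡ α ⇔ AscentsAreRecords d α
selfModified⇔ascentsAreRecords d α =
  ⇔.trans (foldl-fixed⇔all-fixed (Pointwise.refl ≤-refl) (Pointwise.transitive ≤-trans) pointwise-≤-antisym
             M M-inflationary α (ascents d α))
          (mk⇔ allFixed⇒records records⇒allFixed)
  where
  pointwise-≤-antisym : Antisymmetric _≡_ (Pointwise _≤_)
  pointwise-≤-antisym p q = Pointwise-≡⇒≡ (antisymmetric ≤-antisym p q)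

  isAscent? : ∀ p → Dec (isAscAt d α p ≡ true)
  isAscent? = λ p → isAscAt d α p Bool.≟ true

  allFixed⇒records : All (λ j → M α j ≡ α) (ascents d α) → AscentsAreRecords d α
  allFixed⇒records fixed j v asc atj = Equivalence.to (M-fixed⇔ α j)
    (All.lookup fixed (∈-filter⁺ isAscent? (∈-upTo⁺ (at⇒<length α j atj)) (Equivalence.to T-≡ asc))) v atj

  records⇒allFixed : AscentsAreRecords d α → All (λ j → M α j ≡ α) (ascents d α)
  records⇒allFixed records = All.tabulate λ {j} j∈ascents → Equivalence.from (M-fixed⇔ α j) λ v →
    records j v (Equivalence.from T-≡ (proj₂ (∈-filter⁻ isAscent? {xs = upTo (length α)} j∈ascents)))

-- The part of AscentsAreRecords concerning the entries xs that follow a prefix with maximum m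
-- and last entry p.
AscentsAreRecordsAfter : ℕ → ℕ → ℕ → List ℕ → Set
AscentsAreRecordsAfter d m p xs =
  ∀ j v → T (isAscAt d (p ∷ xs) (suc j)) → at xs j ≡ just v → m < v × All (_< v) (take j xs)

ascentsAreRecords-∷ : ∀ d a as → AscentsAreRecords d (a ∷ as) ⇔ AscentsAreRecordsAfter d a a as
ascentsAreRecords-∷ d a as = mk⇔ to from
  where
  to : AscentsAreRecords d (a ∷ as) → AscentsAreRecordsAfter d a a as
  to records j v asc atj = All.uncons (records (suc j) v asc atj)

  from : AscentsAreRecordsAfter d a a as → AscentsAreRecords d (a ∷ as)
  from records zero    v _   _   = []
  from records (suc j) v asc atj = uncurry _∷_ (records j v asc atj)

-- Left-to-right reading of AscentsAreRecordsAfter d m p: m is the running maximum, p the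
-- previous entry, and p <ᵇ b + d says that b is a d-ascent.
data RecordScan (d : ℕ) : ℕ → ℕ → List ℕ → Set where
  []  : ∀ {m p} → RecordScan d m p []
  _∷_ : ∀ {m p b bs} → (T (p <ᵇ b + d) → m < b) → RecordScan d (m ⊔ b) b bs →
        RecordScan d m p (b ∷ bs)

ascentsAreRecordsAfter⇔recordScan : ∀ d m p xs → AscentsAreRecordsAfter d m p xs ⇔ RecordScan d m p xs
ascentsAreRecordsAfter⇔recordScan d m p xs = mk⇔ (to m p xs) (from m p xs)
  where
  to : ∀ m p xs → AscentsAreRecordsAfter d m p xs → RecordScan d m p xs
  to m p []       _       = []
  to m p (b ∷ bs) records = (λ asc → proj₁ (records 0 b asc refl)) ∷ to (m ⊔ b) b bs later
    where
    later : AscentsAreRecordsAfter d (m ⊔ b) b bs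
    later j v asc atj with records (suc j) v asc atj
    ... | m<v , b<v ∷ earlier<v = ⊔-lub m<v b<v , earlier<v

  from : ∀ m p xs → RecordScan d m p xs → AscentsAreRecordsAfter d m p xs
  from m p (b ∷ bs) (isRecord ∷ scan) zero    v asc refl = isRecord asc , []
  from m p (b ∷ bs) (isRecord ∷ scan) (suc j) v asc atj with from (m ⊔ b) b bs scan j v asc atj
  ... | m⊔b<v , earlier<v = ≤-<-trans (m≤m⊔n m b) m⊔b<v , ≤-<-trans (m≤n⊔m m b) m⊔b<v ∷ earlier<v

fromBool : Bool → ℕ
fromBool true  = 1
fromBool false = 0

ascentsAfter : ℕ → ℕ → List ℕ → ℕ
ascentsAfter d p []       = 0
ascentsAfter d p (b ∷ bs) = fromBool (p <ᵇ b + d) + ascentsAfter d b bs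

countBelow : (ℕ → Bool) → ℕ → ℕ
countBelow f zero    = 0
countBelow f (suc n) = fromBool (f 0) + countBelow (f ∘ suc) n

length-filter-applyUpTo : ∀ (f : ℕ → Bool) (g : ℕ → ℕ) n →
  length (filter (λ x → f x Bool.≟ true) (applyUpTo g n)) ≡ countBelow (f ∘ g) n
length-filter-applyUpTo f g zero    = refl
length-filter-applyUpTo f g (suc n) with f (g 0)
... | true  = cong suc (length-filter-applyUpTo f (g ∘ suc) n)
... | false = length-filter-applyUpTo f (g ∘ suc) n

countBelow-isAscAt : ∀ d p xs → countBelow (λ x → isAscAt d (p ∷ xs) (suc x)) (length xs) ≡ ascentsAfter d p xs
countBelow-isAscAt d p []       = refl
countBelow-isAscAt d p (b ∷ bs) = cong (fromBool (p <ᵇ b + d) +_) (countBelow-isAscAt d b bs)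

asc-∷ : ∀ d a xs → asc d (a ∷ xs) ≡ suc (ascentsAfter d a xs)
asc-∷ d a xs = trans (length-filter-applyUpTo (isAscAt d (a ∷ xs)) id (suc (length xs)))
                     (cong suc (countBelow-isAscAt d a xs))

-- Left-to-right reading of the ascent-sequence condition: c counts the d-ascents so far and p is
-- the previous entry.
data AscentScan (d : ℕ) : ℕ → ℕ → List ℕ → Set where
  []  : ∀ {c p} → AscentScan d c p []
  _∷_ : ∀ {c p b bs} → b ≤ suc c → AscentScan d (c + fromBool (p <ᵇ b + d)) b bs →
        AscentScan d c p (b ∷ bs)

ascentBounded⇒ascentScan : ∀ d c p xs →
  ((j : Fin (length xs)) → lookup xs j ≤ suc (c + ascentsAfter d p (take (toℕ j) xs))) →
  AscentScan d c p xs
ascentBounded⇒ascentScan d c p []       _     = []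
ascentBounded⇒ascentScan d c p (b ∷ bs) bound =
  subst (λ n → b ≤ suc n) (+-identityʳ c) (bound fzero) ∷
  ascentBounded⇒ascentScan d (c + fromBool (p <ᵇ b + d)) b bs
    (λ j → subst (λ n → lookup bs j ≤ suc n) (sym (+-assoc c _ _)) (bound (fsuc j)))

isAscentSeq⇒ascentScan : ∀ d a as → IsAscentSeq d (a ∷ as) → AscentScan d 1 a as
isAscentSeq⇒ascentScan d a as (_ , bound) = ascentBounded⇒ascentScan d 1 a as λ j →
  subst (λ n → lookup as j ≤ suc n) (asc-∷ d a (take (toℕ j) as)) (bound (fsuc j))

-- Left-to-right reading of the block form after a prefix that has used the blocks 1, …, m and
-- ends with p.
data BlockScan (d : ℕ) : ℕ → ℕ → List ℕ → Set where
  []        : ∀ {m p} → BlockScan d m p []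
  newBlock  : ∀ {m p xs} → BlockScan d (suc m) (suc m) xs → BlockScan d m p (suc m ∷ xs)
  sameBlock : ∀ {m p x xs} → x + d ≤ p → BlockScan d m x xs → BlockScan d m p (x ∷ xs)

-- Since every ascent is a record, the ascent count and the running maximum are the same number
-- m: an ascent b then satisfies m < b ≤ m + 1.
scans⇒blockScan : ∀ {d m p xs} → AscentScan d m p xs → RecordScan d m p xs → p ≤ m → BlockScan d m p xs
scans⇒blockScan [] [] _ = []
scans⇒blockScan {d} {m} {p} {b ∷ bs} (b≤1+m ∷ counted) (isRecord ∷ records) p≤m
  with p <ᵇ b + d | <ᵇ-reflects-< p (b + d)
... | true  | _ with ≤-antisym b≤1+m (isRecord _)
...   | refl = newBlock (scans⇒blockScan (subst (λ c → AscentScan d c b bs) (+-comm m 1) counted)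
                                          (subst (λ c → RecordScan d c b bs) (m≤n⇒m⊔n≡n (n≤1+n m)) records)
                                          ≤-refl)
scans⇒blockScan {d} {m} {p} {b ∷ bs} (_ ∷ counted) (_ ∷ records) p≤m | false | ofⁿ p≮b+d =
  sameBlock b+d≤p (scans⇒blockScan (subst (λ c → AscentScan d c b bs) (+-identityʳ m) counted)
                                   (subst (λ c → RecordScan d c b bs) (m≥n⇒m⊔n≡m b≤m) records)
                                   b≤m)
  where
  b+d≤p : b + d ≤ p
  b+d≤p = ≮⇒≥ p≮b+d

  b≤m : b ≤ m
  b≤m = ≤-trans (m+n≤o⇒m≤o b b+d≤p) p≤m

blockScan⇒recordScan : ∀ {d m p xs} → BlockScan d m p xs → p ≤ m → RecordScan d m p xs
blockScan⇒recordScan [] _ = []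
blockScan⇒recordScan {d} {m} (newBlock {xs = xs} scan) _ =
  (λ _ → ≤-refl) ∷
  subst (λ c → RecordScan d c (suc m) xs) (sym (m≤n⇒m⊔n≡n (n≤1+n m))) (blockScan⇒recordScan scan ≤-refl)
blockScan⇒recordScan {d} {m} {p} (sameBlock {x = x} {xs} x+d≤p scan) p≤m =
  (λ asc → contradiction (<ᵇ⇒< p (x + d) asc) (≤⇒≯ x+d≤p)) ∷
  subst (λ c → RecordScan d c x xs) (sym (m≥n⇒m⊔n≡m x≤m)) (blockScan⇒recordScan scan x≤m)
  where
  x≤m : x ≤ m
  x≤m = ≤-trans (m+n≤o⇒m≤o x x+d≤p) p≤m

recordScan⇔blockScan : ∀ {d m p xs} → AscentScan d m p xs → p ≤ m → RecordScan d m p xs ⇔ BlockScan d m p xs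
recordScan⇔blockScan counted p≤m =
  mk⇔ (λ records → scans⇒blockScan counted records p≤m) (λ scan → blockScan⇒recordScan scan p≤m)

-- xs is the rest of a word in block form whose prefix has used the blocks 1, …, m and ends with p:
-- xs continues the current block by B and then consists of the blocks m + 1, …, m + length Bs.
BlockDecomposition : ℕ → ℕ → ℕ → List ℕ → Set
BlockDecomposition d m p xs =
  Σ (List ℕ) λ B → Σ (List (List ℕ)) λ Bs →
    xs ≡ B ++ concat (blocks (suc m) Bs) × DecPace d (p ∷ B) × All (DecPace d) (blocks (suc m) Bs) ×
    maxW xs ⊔ m ≡ m + length Bs

blockScan⇒blockDecomposition : ∀ {d m p xs} → BlockScan d m p xs → p ≤ m → BlockDecomposition d m p xs
blockScan⇒blockDecomposition {m = m} {p} [] _ = [] , [] , refl , [ p ] , [] , sym (+-identityʳ m)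
blockScan⇒blockDecomposition {d} {m} {p} {_ ∷ xs} (newBlock scan) _ =
  openBlock (blockScan⇒blockDecomposition scan ≤-refl)
  where
  openBlock : BlockDecomposition d (suc m) (suc m) xs → BlockDecomposition d m p (suc m ∷ xs)
  openBlock (B , Bs , split , pace , paces , max) =
    [] , B ∷ Bs , cong (suc m ∷_) split , [ p ] , pace ∷ paces , (begin
      (suc m ⊔ maxW xs) ⊔ m ≡⟨ m≥n⇒m⊔n≡m (≤-trans (n≤1+n m) (m≤m⊔n (suc m) (maxW xs))) ⟩
      suc m ⊔ maxW xs       ≡⟨ ⊔-comm (suc m) (maxW xs) ⟩
      maxW xs ⊔ suc m       ≡⟨ max ⟩
      suc m + length Bs     ≡⟨ +-suc m (length Bs) ⟨
      m + suc (length Bs)   ∎)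
    where open ≡-Reasoning
blockScan⇒blockDecomposition {d} {m} {p} {_ ∷ xs} (sameBlock {x = x} x+d≤p scan) p≤m =
  extendBlock (blockScan⇒blockDecomposition scan x≤m)
  where
  x≤m : x ≤ m
  x≤m = ≤-trans (m+n≤o⇒m≤o x x+d≤p) p≤m

  extendBlock : BlockDecomposition d m x xs → BlockDecomposition d m p (x ∷ xs)
  extendBlock (B , Bs , split , pace , paces , max) =
    x ∷ B , Bs , cong (x ∷_) split , x+d≤p ∷ pace , paces , (begin
      (x ⊔ maxW xs) ⊔ m ≡⟨ ⊔-assoc x (maxW xs) m ⟩
      x ⊔ (maxW xs ⊔ m) ≡⟨ m≤n⇒m⊔n≡n (≤-trans x≤m (m≤n⊔m (maxW xs) m)) ⟩
      maxW xs ⊔ m       ≡⟨ max ⟩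
      m + length Bs     ∎)
    where open ≡-Reasoning

blockScan-++ : ∀ {d m p ys} B → DecPace d (p ∷ B) → (∀ q → BlockScan d m q ys) → BlockScan d m p (B ++ ys)
blockScan-++ []      _             scan = scan _
blockScan-++ (b ∷ B) (b+d≤p ∷ pace) scan = sameBlock b+d≤p (blockScan-++ B pace scan)

blockScan-blocks : ∀ {d} m Bs → All (DecPace d) (blocks (suc m) Bs) → ∀ p →
  BlockScan d m p (concat (blocks (suc m) Bs))
blockScan-blocks m []       []             _ = []
blockScan-blocks m (B ∷ Bs) (pace ∷ paces) _ = newBlock (blockScan-++ B pace (blockScan-blocks (suc m) Bs paces))

blockScan⇔blockDecomposition : ∀ {d m p xs} → p ≤ m → BlockScan d m p xs ⇔ BlockDecomposition d m p xs
blockScan⇔blockDecomposition {d} {m} {p} p≤m = mk⇔ (λ scan → blockScan⇒blockDecomposition scan p≤m) from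
  where
  from : ∀ {xs} → BlockDecomposition d m p xs → BlockScan d m p xs
  from (B , Bs , refl , pace , paces , _) = blockScan-++ B pace (blockScan-blocks m Bs paces)

hasBlockForm⇔blockDecomposition : ∀ d as → HasBlockForm d (1 ∷ as) ⇔ BlockDecomposition d 1 1 as
hasBlockForm⇔blockDecomposition d as = mk⇔ to from
  where
  to : HasBlockForm d (1 ∷ as) → BlockDecomposition d 1 1 as
  to ([]     , _   , ()    , _)
  to (B ∷ Bs , len , split , pace ∷ paces) =
    B , Bs , sym (∷-injectiveʳ split) , pace , paces , trans (⊔-comm (maxW as) 1) (sym len)

  from : BlockDecomposition d 1 1 as → HasBlockForm d (1 ∷ as)
  from (B , Bs , split , pace , paces , max) =
    B ∷ Bs , sym (trans (⊔-comm 1 (maxW as)) max) , cong (1 ∷_) (sym split) , pace ∷ paces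

lemma4p3 : (d : ℕ) (α : List ℕ) → IsAscentSeq d α →
    (hat d α ≡ α ⇔ HasBlockForm d α)
lemma4p3 d []       _ = mk⇔ (λ _ → [] , refl , refl , []) (λ _ → refl)
lemma4p3 d (a ∷ as) ascentSeq@(1≤a ∷ _ , bound) with ≤-antisym (bound fzero) 1≤a
... | refl = begin
  hat d (1 ∷ as) ≡ 1 ∷ as              ∼⟨ selfModified⇔ascentsAreRecords d (1 ∷ as) ⟩
  AscentsAreRecords d (1 ∷ as)         ∼⟨ ascentsAreRecords-∷ d 1 as ⟩
  AscentsAreRecordsAfter d 1 1 as      ∼⟨ ascentsAreRecordsAfter⇔recordScan d 1 1 as ⟩
  RecordScan d 1 1 as                  ∼⟨ recordScan⇔blockScan (isAscentSeq⇒ascentScan d 1 as ascentSeq) ≤-refl ⟩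
  BlockScan d 1 1 as                   ∼⟨ blockScan⇔blockDecomposition ≤-refl ⟩
  BlockDecomposition d 1 1 as          ∼⟨ ⇔.sym (hasBlockForm⇔blockDecomposition d as) ⟩
  HasBlockForm d (1 ∷ as)              ∎
  where open EquationalReasoning {k = equivalence}
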